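{- Let $t=2$ and $p=\binom{2t}{t}-1=5$. Then $C_{p,q}$ is a submatrix of $A_{k,t}$ if $q=1$ and $k\ge 5$, and also if $q=3$ and $k\ge 6$.
   Context: For positive integers $k,t$ with $k\ge t$, $A_{k,t}$ is the $0,1$-matrix of size $\binom{k}{t}\times\binom{k}{t}$ whose rows and columns are indexed by all $t$-element subsets of $[k]=\{1,\dots,k\}$, with entry $1$ in row $x$, column $y$ if and only if $x\cap y\neq\emptyset$. For integers $p\ge 1$, $q\ge 0$ and $n=p+q$, $C_{p,q}$ is the $n\times n$ circulant $0,1$-matrix whose entry in row $i$, column $j$ ($1\le i,j\le n$) is $1$ iff $(i-j) \bmod n \in\{0,1,\dots,p-1\}$. An $n\times m$ $0,1$-matrix $M$ is a submatrix of $A_{k,t}$ if there are distinct $t$-subsets $F_1,\dots,F_n$ of $[k]$ and distinct $t$-subsets $G_1,\dots,G_m$ of $[k]$ with $M_{ij}=1$ iff $F_i\cap G_j\ne\emptyset$. -}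

module Defs where

open import Data.Nat using (ℕ; _+_; _∸_; _<_; _≥_; NonZero)
open import Data.Nat.DivMod using (_%_)
open import Data.Nat.Combinatorics using (_C_)
open import Data.Fin using (Fin; toℕ)
open import Data.Fin.Subset using (Subset; _∩_; ∣_∣; Nonempty)
open import Data.Bool using (Bool; true)
open import Data.Product using (Σ; _×_)
open import Function.Definitions using (Injective)
open import Relation.Binary.PropositionalEquality using (_≡_)
open import Relation.Nullary using (¬_)
open import Relation.Nullary.Decidable using (⌊_⌋)
open import Data.Nat.Properties using (_<?_)

-- An n × m 0,1-matrix, entries as Bool (true = 1), rows/columns indexed by Fin (0-based).
Matrix01 : ℕ → ℕ → Set
Matrix01 n m = Fin n → Fin m → Bool

IsTSubset : (k t : ℕ) → Subset k → Set
IsTSubset k t x = ∣ x ∣ ≡ t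

-- Circulant C_{p,q}: entry (i,j) is 1 iff (i - j) mod n ∈ {0,…,p-1}, n = p+q.
-- With 0-based indices i,j < n, (i - j) mod n = (n + i ∸ j) % n.
circ : (p q : ℕ) → .{{NonZero (p + q)}} → Matrix01 (p + q) (p + q)
circ p q i j = ⌊ ((p + q + toℕ i) ∸ toℕ j) % (p + q) <? p ⌋

-- M is a submatrix of A_{k,t}: there are distinct t-subsets F_1..F_n, G_1..G_m
-- with M_ij = 1 iff F_i ∩ G_j ≠ ∅.
IsSubmatrixOfA : (k t : ℕ) {n m : ℕ} → Matrix01 n m → Set
IsSubmatrixOfA k t {n} {m} M =
  Σ (Fin n → Subset k) λ F →
  Σ (Fin m → Subset k) λ G →
    ((i : Fin n) → IsTSubset k t (F i)) ×
    ((j : Fin m) → IsTSubset k t (G j)) ×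
    Injective _≡_ _≡_ F ×
    Injective _≡_ _≡_ G ×
    ((i : Fin n) (j : Fin m) → (M i j ≡ true → Nonempty (F i ∩ G j)) ×
                               (Nonempty (F i ∩ G j) → M i j ≡ true))

module Submission where

-- The proof has three ingredients.
--   * Realisation: if such families F, G merely *realise* M (the meeting pattern is
--     M, cardinalities are t) and M has no repeated rows and no repeated columns,
--     then F and G are automatically injective, so M is a submatrix of A_{k,t}.
--   * Monotonicity: padding every subset of [k] with k' - k absent elements turns a
--     representation in A_{k,t} into one in A_{k',t}; hence the property is upward
--     closed in k.
--   * Two explicit realisations, verified by evaluation: C_{5,1} inside A_{4,2}
--     (the six 2-subsets of [4], column j being the complement of row j - 1)
--     and C_{5,3} inside A_{6,2}.
-- The theorem follows by monotonicity from 4 ≤ 5 ≤ k and 6 ≤ k.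

open import Defs
open import Data.Nat using (ℕ; _+_; _≤_; _≥_)
open import Data.Nat.Properties using (<⇒≤; m≤n⇒∃[o]m+o≡n)
import Data.Nat.Properties as ℕ
open import Data.Fin using (Fin; zero; suc; #_)
import Data.Fin.Properties as Fin
open import Data.Fin.Subset using (Subset; _∩_; _∪_; ∣_∣; Nonempty; ⊥; ⁅_⁆; inside; outside)
open import Data.Fin.Subset.Properties using (nonempty?; ∉⊥; ∣⊥∣≡0; ∩-comm; ∩-zeroʳ)
open import Data.Vec using ([]; _∷_; _++_; lookup; here; there)
open import Data.Vec.Properties using (zipWith-++; ++-injectiveˡ)
open import Data.Bool using (true)
import Data.Bool.Properties as Bool
open import Data.Empty using (⊥-elim)
open import Data.Product using (_×_; _,_)
open import Function.Definitions using (Injective)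
open import Relation.Binary.PropositionalEquality
  using (_≡_; refl; sym; trans; cong; subst; module ≡-Reasoning)
open import Relation.Nullary using (Dec; yes; no)
open import Relation.Nullary.Decidable using (⌊_⌋; from-yes; _→-dec_)

private
  variable
    k n m : ℕ

⌊⌋≡true⇔ : {P : Set} (P? : Dec P) → (⌊ P? ⌋ ≡ true → P) × (P → ⌊ P? ⌋ ≡ true)
⌊⌋≡true⇔ (yes p) = (λ _ → p) , (λ _ → refl)
⌊⌋≡true⇔ (no ¬p) = (λ ()) , (λ p → ⊥-elim (¬p p))

Realises : Matrix01 n m → (Fin n → Subset k) → (Fin m → Subset k) → Set
Realises M F G = ∀ i j → M i j ≡ ⌊ nonempty? (F i ∩ G j) ⌋

realises? : (M : Matrix01 n m) (F : Fin n → Subset k) (G : Fin m → Subset k) →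
            Dec (Realises M F G)
realises? M F G = Fin.all? λ i → Fin.all? λ j → M i j Bool.≟ ⌊ nonempty? (F i ∩ G j) ⌋

transpose : Matrix01 n m → Matrix01 m n
transpose M j i = M i j

realises-transpose : {M : Matrix01 n m} {F : Fin n → Subset k} {G : Fin m → Subset k} →
                     Realises M F G → Realises (transpose M) G F
realises-transpose {F = F} {G} real j i =
  trans (real i j) (cong (λ X → ⌊ nonempty? X ⌋) (∩-comm (F i) (G j)))

DistinctRows : Matrix01 n m → Set
DistinctRows M = ∀ i i′ → (∀ j → M i j ≡ M i′ j) → i ≡ i′

distinctRows? : (M : Matrix01 n m) → Dec (DistinctRows M)
distinctRows? M = Fin.all? λ i → Fin.all? λ i′ →
  Fin.all? (λ j → M i j Bool.≟ M i′ j) →-dec (i Fin.≟ i′)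

-- Equal subsets produce equal rows, so distinct rows force distinct subsets.
distinctRows⇒injective : {M : Matrix01 n m} {F : Fin n → Subset k} {G : Fin m → Subset k} →
                         Realises M F G → DistinctRows M → Injective _≡_ _≡_ F
distinctRows⇒injective {M = M} {F} {G} real distinct {i} {i′} Fi≡Fi′ =
  distinct i i′ sameRow
  where
  open ≡-Reasoning
  sameRow : ∀ j → M i j ≡ M i′ j
  sameRow j = begin
    M i j                           ≡⟨ real i j ⟩
    ⌊ nonempty? (F i ∩ G j) ⌋       ≡⟨ cong (λ X → ⌊ nonempty? (X ∩ G j) ⌋) Fi≡Fi′ ⟩
    ⌊ nonempty? (F i′ ∩ G j) ⌋      ≡⟨ sym (real i′ j) ⟩
    M i′ j                          ∎

realisation⇒submatrix : {t : ℕ} {M : Matrix01 n m}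
                        (F : Fin n → Subset k) (G : Fin m → Subset k) →
                        Realises M F G → DistinctRows M → DistinctRows (transpose M) →
                        (∀ i → ∣ F i ∣ ≡ t) → (∀ j → ∣ G j ∣ ≡ t) →
                        IsSubmatrixOfA k t M
realisation⇒submatrix F G real rows cols ∣F∣ ∣G∣ =
  F , G , ∣F∣ , ∣G∣ ,
  distinctRows⇒injective real rows ,
  distinctRows⇒injective (realises-transpose real) cols ,
  λ i j → subst (λ b → (b ≡ true → _) × (_ → b ≡ true)) (sym (real i j))
                (⌊⌋≡true⇔ (nonempty? (F i ∩ G j)))

pad : ∀ d → Subset k → Subset (k + d)
pad d x = x ++ ⊥

pad-∩ : ∀ d (x y : Subset k) → pad d x ∩ pad d y ≡ pad d (x ∩ y)
pad-∩ d x y = trans (zipWith-++ _ x ⊥ y ⊥) (cong ((x ∩ y) ++_) (∩-zeroʳ ⊥))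

pad-∣∣ : ∀ d (x : Subset k) → ∣ pad d x ∣ ≡ ∣ x ∣
pad-∣∣ d []            = ∣⊥∣≡0 d
pad-∣∣ d (inside ∷ x)  = cong ℕ.suc (pad-∣∣ d x)
pad-∣∣ d (outside ∷ x) = pad-∣∣ d x

pad-injective : ∀ d {x y : Subset k} → pad d x ≡ pad d y → x ≡ y
pad-injective d {x} {y} = ++-injectiveˡ x y

pad-nonempty⁺ : ∀ d {x : Subset k} → Nonempty x → Nonempty (pad d x)
pad-nonempty⁺ d (zero  , here)      = zero , here
pad-nonempty⁺ d (suc i , there i∈x) with pad-nonempty⁺ d (i , i∈x)
... | j , j∈pad = suc j , there j∈pad

pad-nonempty⁻ : ∀ d (x : Subset k) → Nonempty (pad d x) → Nonempty x
pad-nonempty⁻ d []      (i , i∈⊥)          = ⊥-elim (∉⊥ i∈⊥)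
pad-nonempty⁻ d (_ ∷ x) (zero  , here)      = zero , here
pad-nonempty⁻ d (_ ∷ x) (suc i , there i∈x) with pad-nonempty⁻ d x (i , i∈x)
... | j , j∈x = suc j , there j∈x

submatrix-mono : {k′ t : ℕ} {M : Matrix01 n m} → k ≤ k′ →
                 IsSubmatrixOfA k t M → IsSubmatrixOfA k′ t M
submatrix-mono {k = k} {t = t} {M = M} k≤k′ rep with m≤n⇒∃[o]m+o≡n k≤k′
... | d , refl = padded rep
  where
  padded : IsSubmatrixOfA k t M → IsSubmatrixOfA (k + d) t M
  padded (F , G , ∣F∣ , ∣G∣ , F-inj , G-inj , meets) =
    (λ i → pad d (F i)) , (λ j → pad d (G j)) ,
    (λ i → trans (pad-∣∣ d (F i)) (∣F∣ i)) ,
    (λ j → trans (pad-∣∣ d (G j)) (∣G∣ j)) ,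
    (λ e → F-inj (pad-injective d e)) ,
    (λ e → G-inj (pad-injective d e)) ,
    λ i j → let (M⇒meet , meet⇒M) = meets i j
                padded-meet = pad-∩ d (F i) (G j) in
      (λ Mij → subst Nonempty (sym padded-meet) (pad-nonempty⁺ d (M⇒meet Mij))) ,
      (λ meet → meet⇒M (pad-nonempty⁻ d _ (subst Nonempty padded-meet meet)))

pair : Fin k → Fin k → Subset k
pair a b = ⁅ a ⁆ ∪ ⁅ b ⁆

-- Rows: the six 2-subsets of [4]; column j is the complement of row j - 1 (mod 6),
-- so it meets every row but that one. Thus C_{5,1} already lives in A_{4,2}.
rows₅₁ columns₅₁ : Fin 6 → Subset 4
rows₅₁ = lookup (pair (# 0) (# 1) ∷ pair (# 0) (# 2) ∷ pair (# 0) (# 3) ∷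
                 pair (# 1) (# 2) ∷ pair (# 1) (# 3) ∷ pair (# 2) (# 3) ∷ [])
columns₅₁ = lookup (pair (# 0) (# 1) ∷ pair (# 2) (# 3) ∷ pair (# 1) (# 3) ∷
                    pair (# 1) (# 2) ∷ pair (# 0) (# 3) ∷ pair (# 0) (# 2) ∷ [])

C₅₁⊆A₄₂ : IsSubmatrixOfA 4 2 (circ 5 1)
C₅₁⊆A₄₂ = realisation⇒submatrix rows₅₁ columns₅₁
  (from-yes (realises? (circ 5 1) rows₅₁ columns₅₁))
  (from-yes (distinctRows? (circ 5 1)))
  (from-yes (distinctRows? (transpose (circ 5 1))))
  (from-yes (Fin.all? λ i → ∣ rows₅₁ i ∣ ℕ.≟ 2))
  (from-yes (Fin.all? λ j → ∣ columns₅₁ j ∣ ℕ.≟ 2))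

rows₅₃ columns₅₃ : Fin 8 → Subset 6
rows₅₃ = lookup (pair (# 0) (# 1) ∷ pair (# 0) (# 3) ∷ pair (# 0) (# 2) ∷ pair (# 2) (# 5) ∷
                 pair (# 2) (# 4) ∷ pair (# 3) (# 4) ∷ pair (# 1) (# 4) ∷ pair (# 1) (# 5) ∷ [])
columns₅₃ = lookup (pair (# 0) (# 2) ∷ pair (# 2) (# 3) ∷ pair (# 2) (# 4) ∷ pair (# 4) (# 5) ∷
                    pair (# 1) (# 4) ∷ pair (# 1) (# 3) ∷ pair (# 0) (# 1) ∷ pair (# 0) (# 5) ∷ [])

C₅₃⊆A₆₂ : IsSubmatrixOfA 6 2 (circ 5 3)
C₅₃⊆A₆₂ = realisation⇒submatrix rows₅₃ columns₅₃
  (from-yes (realises? (circ 5 3) rows₅₃ columns₅₃))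
  (from-yes (distinctRows? (circ 5 3)))
  (from-yes (distinctRows? (transpose (circ 5 3))))
  (from-yes (Fin.all? λ i → ∣ rows₅₃ i ∣ ℕ.≟ 2))
  (from-yes (Fin.all? λ j → ∣ columns₅₃ j ∣ ℕ.≟ 2))

mainTheorem11 : ((k : ℕ) → k ≥ 5 → IsSubmatrixOfA k 2 (circ 5 1)) × ((k : ℕ) → k ≥ 6 → IsSubmatrixOfA k 2 (circ 5 3))
mainTheorem11 =
  (λ k k≥5 → submatrix-mono (<⇒≤ k≥5) C₅₁⊆A₄₂) ,
  (λ k k≥6 → submatrix-mono k≥6 C₅₃⊆A₆₂)
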